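{- Let $(\mathcal{C},\otimes,I,\sigma,\mathsf{tr})$ be a traced symmetric strict monoidal category, and let $\approx_{\mathcal{C}}$ be the smallest relation on pairs of parallel morphisms of $\mathcal{C}$ such that: (r) $f\approx f$ for all $f$; (t) $f\approx g$ and $g\approx h$ imply $f\approx h$; (s) $f\approx g$ implies $g\approx f$; (;) $f\approx f'$ and $g\approx g'$ imply $f;g\approx f';g'$ whenever these composites are defined; ($\otimes$) $f\approx f'$ and $g\approx g'$ imply $f\otimes g\approx f'\otimes g'$; (ut) if $u,v\colon S\to T$, $f\colon S\otimes X\to S\otimes Y$, $g\colon T\otimes X\to T\otimes Y$ satisfy $u\approx v$ and $f;(u\otimes \mathrm{id}_Y)\approx (v\otimes\mathrm{id}_X);g$, then $\mathsf{tr}_S f\approx \mathsf{tr}_T g$. Let $\mathrm{Unif}(\mathcal{C})$ be the category whose objects are those of $\mathcal{C}$ and whose morphisms $X\to Y$ are $\approx_{\mathcal{C}}$-equivalence classes $[f]$ of morphisms $f\colon X\to Y$ of $\mathcal{C}$, with $[f];[g]:=[f;g]$, $[f]\otimes[g]:=[f\otimes g]$, symmetries $[\sigma_{X,Y}]$ and $\mathsf{tr}_S[f]:=[\mathsf{tr}_S f]$. Then these operations are well defined and make $\mathrm{Unif}(\mathcal{C})$ a uniformly traced symmetric strict monoidal category.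
   Context: Composition is written in diagrammatic order: $f;g$ means first $f$ then $g$. A traced symmetric strict monoidal category is a symmetric strict monoidal category $(\mathcal{C},\otimes,I,\sigma)$ with operators $\mathsf{tr}_S\colon\mathcal{C}(S\otimes X,S\otimes Y)\to\mathcal{C}(X,Y)$ for all objects $S,X,Y$ satisfying: tightening $\mathsf{tr}_S((\mathrm{id}_S\otimes u);f;(\mathrm{id}_S\otimes v))=u;\mathsf{tr}_S f;v$; strength $\mathsf{tr}_S(f\otimes g)=\mathsf{tr}_S f\otimes g$; joining $\mathsf{tr}_T\mathsf{tr}_S f=\mathsf{tr}_{S\otimes T}f$; vanishing $\mathsf{tr}_I f=f$; sliding $\mathsf{tr}_T(f;(u\otimes\mathrm{id}_Y))=\mathsf{tr}_S((u\otimes\mathrm{id}_X);f)$ for $f\colon S\otimes X\to T\otimes Y$, $u\colon T\to S$; yanking $\mathsf{tr}_S\sigma_{S,S}=\mathrm{id}_S$ (all for suitably typed morphisms). It is uniformly traced if moreover, for all $f\colon S\otimes X\to S\otimes Y$, $g\colon T\otimes X\to T\otimes Y$, $r\colon S\to T$: if $f;(r\otimes\mathrm{id}_Y)=(r\otimes\mathrm{id}_X);g$ then $\mathsf{tr}_S f=\mathsf{tr}_T g$. -}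

module Defs where

open import Level using (Level; _⊔_; suc)
open import Relation.Binary.PropositionalEquality using (_≡_; refl; sym)
open import Relation.Binary.Structures using (IsEquivalence)

-- Raw data of a (traced, symmetric, strict) monoidal category, diagrammatic
-- composition _⨾_ (f ⨾ g = first f then g).
record Ops {o ℓ : Level} (Obj : Set o) (Hom : Obj → Obj → Set ℓ) : Set (o ⊔ ℓ) where
  infixr 9 _⨾_
  infixr 10 _⊗₀_ _⊗₁_
  field
    id   : ∀ {X} → Hom X X
    _⨾_  : ∀ {X Y Z} → Hom X Y → Hom Y Z → Hom X Z
    I    : Obj
    _⊗₀_ : Obj → Obj → Obj
    _⊗₁_ : ∀ {X Y X′ Y′} → Hom X Y → Hom X′ Y′ → Hom (X ⊗₀ X′) (Y ⊗₀ Y′)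
    σ    : ∀ X Y → Hom (X ⊗₀ Y) (Y ⊗₀ X)
    tr   : ∀ S {X Y} → Hom (S ⊗₀ X) (S ⊗₀ Y) → Hom X Y

  cast : ∀ {X Y} → X ≡ Y → Hom X Y
  cast refl = id

-- A traced symmetric strict monoidal category structure on the given raw data,
-- with equality of morphisms given by the relation _∼_ (for an ordinary
-- category: _≡_; for a quotient category: the quotienting equivalence, in which
-- case the congruence fields say that the operations are well defined).
record IsTracedSSMC {o ℓ e : Level} {Obj : Set o} {Hom : Obj → Obj → Set ℓ}
         (ops : Ops Obj Hom) (_∼_ : ∀ {X Y} → Hom X Y → Hom X Y → Set e)
         : Set (o ⊔ ℓ ⊔ e) where
  open Ops ops
  field
    isEquivalence : ∀ {X Y} → IsEquivalence (_∼_ {X} {Y})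
    ⨾-cong  : ∀ {X Y Z} {f f′ : Hom X Y} {g g′ : Hom Y Z} →
              f ∼ f′ → g ∼ g′ → (f ⨾ g) ∼ (f′ ⨾ g′)
    ⊗-cong  : ∀ {X Y X′ Y′} {f f′ : Hom X Y} {g g′ : Hom X′ Y′} →
              f ∼ f′ → g ∼ g′ → (f ⊗₁ g) ∼ (f′ ⊗₁ g′)
    tr-cong : ∀ {S X Y} {f f′ : Hom (S ⊗₀ X) (S ⊗₀ Y)} →
              f ∼ f′ → tr S f ∼ tr S f′
    identityˡ : ∀ {X Y} {f : Hom X Y} → (id ⨾ f) ∼ f
    identityʳ : ∀ {X Y} {f : Hom X Y} → (f ⨾ id) ∼ f
    assoc     : ∀ {W X Y Z} {f : Hom W X} {g : Hom X Y} {h : Hom Y Z} →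
                ((f ⨾ g) ⨾ h) ∼ (f ⨾ (g ⨾ h))
    ⊗-id : ∀ {X Y} → (id {X} ⊗₁ id {Y}) ∼ id
    ⊗-⨾  : ∀ {X Y Z X′ Y′ Z′} {f : Hom X Y} {g : Hom Y Z} {f′ : Hom X′ Y′} {g′ : Hom Y′ Z′} →
           ((f ⨾ g) ⊗₁ (f′ ⨾ g′)) ∼ ((f ⊗₁ f′) ⨾ (g ⊗₁ g′))
    ⊗-assoc₀  : ∀ X Y Z → (X ⊗₀ Y) ⊗₀ Z ≡ X ⊗₀ (Y ⊗₀ Z)
    ⊗-unitˡ₀  : ∀ X → I ⊗₀ X ≡ X
    ⊗-unitʳ₀  : ∀ X → X ⊗₀ I ≡ X
    ⊗-assoc₁  : ∀ {X Y Z X′ Y′ Z′} {f : Hom X X′} {g : Hom Y Y′} {h : Hom Z Z′} →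
                (((f ⊗₁ g) ⊗₁ h) ⨾ cast (⊗-assoc₀ X′ Y′ Z′))
                  ∼ (cast (⊗-assoc₀ X Y Z) ⨾ (f ⊗₁ (g ⊗₁ h)))
    ⊗-unitˡ₁  : ∀ {X Y} {f : Hom X Y} →
                ((id {I} ⊗₁ f) ⨾ cast (⊗-unitˡ₀ Y)) ∼ (cast (⊗-unitˡ₀ X) ⨾ f)
    ⊗-unitʳ₁  : ∀ {X Y} {f : Hom X Y} →
                ((f ⊗₁ id {I}) ⨾ cast (⊗-unitʳ₀ Y)) ∼ (cast (⊗-unitʳ₀ X) ⨾ f)
    σ-natural : ∀ {X Y X′ Y′} {f : Hom X Y} {g : Hom X′ Y′} →
                ((f ⊗₁ g) ⨾ σ Y Y′) ∼ (σ X X′ ⨾ (g ⊗₁ f))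
    σ-involutive : ∀ {X Y} → (σ X Y ⨾ σ Y X) ∼ id
    σ-hexagon : ∀ {X Y Z} →
                σ X (Y ⊗₀ Z) ∼
                  (cast (sym (⊗-assoc₀ X Y Z)) ⨾ (σ X Y ⊗₁ id {Z}) ⨾ cast (⊗-assoc₀ Y X Z)
                     ⨾ (id {Y} ⊗₁ σ X Z) ⨾ cast (sym (⊗-assoc₀ Y Z X)))
    tightening : ∀ {S X X′ Y Y′} {u : Hom X′ X} {f : Hom (S ⊗₀ X) (S ⊗₀ Y)} {v : Hom Y Y′} →
                 tr S ((id {S} ⊗₁ u) ⨾ f ⨾ (id {S} ⊗₁ v)) ∼ (u ⨾ tr S f ⨾ v)
    strength   : ∀ {S X Y Z W} {f : Hom (S ⊗₀ X) (S ⊗₀ Y)} {g : Hom Z W} →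
                 tr S (cast (sym (⊗-assoc₀ S X Z)) ⨾ (f ⊗₁ g) ⨾ cast (⊗-assoc₀ S Y W))
                   ∼ (tr S f ⊗₁ g)
    joining    : ∀ {S T X Y} {f : Hom (S ⊗₀ (T ⊗₀ X)) (S ⊗₀ (T ⊗₀ Y))} →
                 tr T (tr S f)
                   ∼ tr (S ⊗₀ T) (cast (⊗-assoc₀ S T X) ⨾ f ⨾ cast (sym (⊗-assoc₀ S T Y)))
    vanishing  : ∀ {X Y} {f : Hom (I ⊗₀ X) (I ⊗₀ Y)} →
                 tr I f ∼ (cast (sym (⊗-unitˡ₀ X)) ⨾ f ⨾ cast (⊗-unitˡ₀ Y))
    sliding    : ∀ {S T X Y} {f : Hom (S ⊗₀ X) (T ⊗₀ Y)} {u : Hom T S} →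
                 tr S (f ⨾ (u ⊗₁ id {Y})) ∼ tr T ((u ⊗₁ id {X}) ⨾ f)
    yanking    : ∀ {S} → tr S (σ S S) ∼ id

record IsUniformlyTracedSSMC {o ℓ e : Level} {Obj : Set o} {Hom : Obj → Obj → Set ℓ}
         (ops : Ops Obj Hom) (_∼_ : ∀ {X Y} → Hom X Y → Hom X Y → Set e)
         : Set (o ⊔ ℓ ⊔ e) where
  open Ops ops
  field
    isTracedSSMC : IsTracedSSMC ops _∼_
    uniformity   : ∀ {S T X Y} {f : Hom (S ⊗₀ X) (S ⊗₀ Y)} {g : Hom (T ⊗₀ X) (T ⊗₀ Y)}
                     {r : Hom S T} →
                   (f ⨾ (r ⊗₁ id {Y})) ∼ ((r ⊗₁ id {X}) ⨾ g) → tr S f ∼ tr T g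

module _ {o ℓ : Level} {Obj : Set o} {Hom : Obj → Obj → Set ℓ} (ops : Ops Obj Hom) where
  open Ops ops

  data UnifRel : ∀ {X Y} → Hom X Y → Hom X Y → Set (o ⊔ ℓ) where
    ≈-refl  : ∀ {X Y} {f : Hom X Y} → UnifRel f f
    ≈-trans : ∀ {X Y} {f g h : Hom X Y} → UnifRel f g → UnifRel g h → UnifRel f h
    ≈-sym   : ∀ {X Y} {f g : Hom X Y} → UnifRel f g → UnifRel g f
    ≈-⨾     : ∀ {X Y Z} {f f′ : Hom X Y} {g g′ : Hom Y Z} →
              UnifRel f f′ → UnifRel g g′ → UnifRel (f ⨾ g) (f′ ⨾ g′)
    ≈-⊗     : ∀ {X Y X′ Y′} {f f′ : Hom X Y} {g g′ : Hom X′ Y′} →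
              UnifRel f f′ → UnifRel g g′ → UnifRel (f ⊗₁ g) (f′ ⊗₁ g′)
    ≈-ut    : ∀ {S T X Y} {u v : Hom S T}
                {f : Hom (S ⊗₀ X) (S ⊗₀ Y)} {g : Hom (T ⊗₀ X) (T ⊗₀ Y)} →
              UnifRel u v → UnifRel (f ⨾ (u ⊗₁ id {Y})) ((v ⊗₁ id {X}) ⨾ g) →
              UnifRel (tr S f) (tr T g)

{-# OPTIONS --safe #-}
-- The relation ≈ contains equality and is by construction an equivalence and a
-- congruence for ⨾ and ⊗. Rule (ut) with u = v = id, combined with the unit laws
-- of C, makes it a congruence for tr as well, and with u = v = r it is exactly
-- uniformity. Every axiom of a traced SSMC, holding as an equation in C, therefore
-- holds up to ≈.
module Submission where

open import Defs
open import Level using (Level)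
open import Relation.Binary.Bundles using (Setoid)
open import Relation.Binary.PropositionalEquality using (_≡_; refl; cong)
open import Relation.Binary.Structures using (IsEquivalence)
import Relation.Binary.Reasoning.Setoid as SetoidReasoning

module _ {o ℓ e e′ : Level} {Obj : Set o} {Hom : Obj → Obj → Set ℓ} {ops : Ops Obj Hom}
         {_∼_ : ∀ {X Y} → Hom X Y → Hom X Y → Set e}
         {_≈_ : ∀ {X Y} → Hom X Y → Hom X Y → Set e′} where
  open Ops ops

  IsTracedSSMC-coarsen :
    (∀ {X Y} {f g : Hom X Y} → f ∼ g → f ≈ g) →
    (∀ {X Y} → IsEquivalence (_≈_ {X} {Y})) →
    (∀ {X Y Z} {f f′ : Hom X Y} {g g′ : Hom Y Z} → f ≈ f′ → g ≈ g′ → (f ⨾ g) ≈ (f′ ⨾ g′)) →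
    (∀ {X Y X′ Y′} {f f′ : Hom X Y} {g g′ : Hom X′ Y′} →
       f ≈ f′ → g ≈ g′ → (f ⊗₁ g) ≈ (f′ ⊗₁ g′)) →
    (∀ {S X Y} {f f′ : Hom (S ⊗₀ X) (S ⊗₀ Y)} → f ≈ f′ → tr S f ≈ tr S f′) →
    IsTracedSSMC ops _∼_ → IsTracedSSMC ops _≈_
  IsTracedSSMC-coarsen ∼⇒≈ isEq ⨾-cong ⊗-cong tr-cong C = record
    { isEquivalence = isEq
    ; ⨾-cong        = ⨾-cong
    ; ⊗-cong        = ⊗-cong
    ; tr-cong       = tr-cong
    ; identityˡ     = ∼⇒≈ identityˡ
    ; identityʳ     = ∼⇒≈ identityʳ
    ; assoc         = ∼⇒≈ assoc
    ; ⊗-id          = ∼⇒≈ ⊗-id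
    ; ⊗-⨾           = ∼⇒≈ ⊗-⨾
    ; ⊗-assoc₀      = ⊗-assoc₀
    ; ⊗-unitˡ₀      = ⊗-unitˡ₀
    ; ⊗-unitʳ₀      = ⊗-unitʳ₀
    ; ⊗-assoc₁      = ∼⇒≈ ⊗-assoc₁
    ; ⊗-unitˡ₁      = ∼⇒≈ ⊗-unitˡ₁
    ; ⊗-unitʳ₁      = ∼⇒≈ ⊗-unitʳ₁
    ; σ-natural     = ∼⇒≈ σ-natural
    ; σ-involutive  = ∼⇒≈ σ-involutive
    ; σ-hexagon     = ∼⇒≈ σ-hexagon
    ; tightening    = ∼⇒≈ tightening
    ; strength      = ∼⇒≈ strength
    ; joining       = ∼⇒≈ joining
    ; vanishing     = ∼⇒≈ vanishing
    ; sliding       = ∼⇒≈ sliding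
    ; yanking       = ∼⇒≈ yanking
    }
    where open IsTracedSSMC C hiding (isEquivalence; ⨾-cong; ⊗-cong; tr-cong)

module _ {o ℓ : Level} {Obj : Set o} {Hom : Obj → Obj → Set ℓ} (ops : Ops Obj Hom) where
  open Ops ops

  private
    _≈_ : ∀ {X Y} → Hom X Y → Hom X Y → Set _
    _≈_ = UnifRel ops

  ≡⇒UnifRel : ∀ {X Y} {f g : Hom X Y} → f ≡ g → f ≈ g
  ≡⇒UnifRel refl = ≈-refl

  UnifRel-isEquivalence : ∀ {X Y} → IsEquivalence (_≈_ {X} {Y})
  UnifRel-isEquivalence = record { refl = ≈-refl ; sym = ≈-sym ; trans = ≈-trans }

  UnifRel-setoid : ∀ X Y → Setoid _ _
  UnifRel-setoid X Y = record { isEquivalence = UnifRel-isEquivalence {X} {Y} }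

  UnifRel-uniformity : ∀ {S T X Y} {f : Hom (S ⊗₀ X) (S ⊗₀ Y)} {g : Hom (T ⊗₀ X) (T ⊗₀ Y)}
                         {r : Hom S T} →
                       (f ⨾ (r ⊗₁ id {Y})) ≈ ((r ⊗₁ id {X}) ⨾ g) → tr S f ≈ tr T g
  UnifRel-uniformity = ≈-ut ≈-refl

  UnifRel-tr-cong : IsTracedSSMC ops _≡_ →
                    ∀ {S X Y} {f f′ : Hom (S ⊗₀ X) (S ⊗₀ Y)} → f ≈ f′ → tr S f ≈ tr S f′
  UnifRel-tr-cong C {S} {X} {Y} {f} {f′} f≈f′ = ≈-ut ≈-refl (begin
    f ⨾ (id ⊗₁ id)   ≡⟨ cong (f ⨾_) ⊗-id ⟩
    f ⨾ id           ≡⟨ identityʳ ⟩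
    f                ≈⟨ f≈f′ ⟩
    f′               ≡⟨ identityˡ ⟨
    id ⨾ f′          ≡⟨ cong (_⨾ f′) ⊗-id ⟨
    (id ⊗₁ id) ⨾ f′  ∎)
    where
    open IsTracedSSMC C
    open SetoidReasoning (UnifRel-setoid (S ⊗₀ X) (S ⊗₀ Y))

proposition4p4 : ∀ {o ℓ : Level} {Obj : Set o} {Hom : Obj → Obj → Set ℓ}
                   (ops : Ops Obj Hom) →
                   IsTracedSSMC ops _≡_ →
                   IsUniformlyTracedSSMC ops (UnifRel ops)
proposition4p4 ops C = record
  { isTracedSSMC = IsTracedSSMC-coarsen (≡⇒UnifRel ops) (UnifRel-isEquivalence ops)
                     ≈-⨾ ≈-⊗ (UnifRel-tr-cong ops C) C
  ; uniformity   = UnifRel-uniformity ops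
  }
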